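{- Let $G$ be a graph with a fixed total order on its edges, $d,\ell$ integers, and $(A,B)$ an independent pair. Then: (a) for all $a\neq a'$ in $A$ and $b\neq b'$ in $B$, every vertex of $P_{ab}$ and every vertex of $P_{a'b'}$ are at distance at least $4$; (b) for all $a\neq a'$ in $A$, $d(RS(a),RS(a'))\ge 4$, and for all $b\neq b'$ in $B$, $d(RS(b),RS(b'))\ge 4$.
   Context: $d(x,y)$ is shortest-path distance in $G$, $B(x,k)=\{y:d(x,y)\le k\}$; the distance between two vertex sets is the minimum distance between their elements. Extend the edge order to paths by comparing from the end: a path with no edge is smallest; if two paths have the same last edge compare them with that edge removed; otherwise compare their last edges. $P_{ab}$ is the path from $a$ to $b$ of minimum length that is smallest in this order among minimum-length paths. A pair $(A,B)$ of disjoint vertex sets is $d$-localized if the vertices of $A\cup B$ are pairwise at distance at least $\ell+1$ and $d(a,b)\le 2\ell-2^{d+2}-3$ for $a\in A,b\in B$. For $a\in A,b\in B$, $c_{ab}$ (resp. $c_{ba}$) is the vertex of $P_{ab}$ at distance $\ell-3$ from $a$ (resp. $b$). A $d$-localized pair is independent if for all $a\in A,b\in B$, $B(c_{ab},\ell)\cap(A\cup B)=\{a,b\}$ and $B(c_{ba},\ell)\cap(A\cup B)=\{a,b\}$. The root section $RS(a)$ of $a\in A$ is the set of vertices of the subpaths of $P_{ab}$ from $a$ to $c_{ab}$, over all $b\in B$; the root section $RS(b)$ of $b\in B$ is the set of vertices of the subpaths of $P_{ab}$ from $c_{ba}$ to $b$, over all $a\in A$. -}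

module Defs where

open import Data.Nat using (ℕ; zero; suc; _+_; _*_; _∸_; _^_; _≤_)
open import Data.List using (List; []; _∷_; _∷ʳ_)
open import Data.List.Membership.Propositional using (_∈_)
open import Data.Product using (Σ; ∃; _×_; _,_)
open import Data.Sum using (_⊎_)
open import Data.Empty using (⊥)
open import Relation.Nullary using (¬_)
open import Relation.Binary.PropositionalEquality using (_≡_; _≢_)

record Graph : Set₁ where
  field
    V        : Set
    Adj      : V → V → Set
    Adj-sym  : ∀ {x y} → Adj x y → Adj y x
    Adj-irr  : ∀ {x} → ¬ Adj x x

module _ (G : Graph) where
  open Graph G

  SameEdge : V → V → V → V → Set
  SameEdge x y u v = (x ≡ u × y ≡ v) ⊎ (x ≡ v × y ≡ u)

  -- A fixed (strict) total order on the edges of G.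
  -- EdgeLt x y u v means: edge {x,y} < edge {u,v}.
  record EdgeOrder : Set₁ where
    field
      EdgeLt : V → V → V → V → Set
      -- it is a relation on unordered pairs
      <E-swapˡ : ∀ {x y u v} → EdgeLt x y u v → EdgeLt y x u v
      <E-swapʳ : ∀ {x y u v} → EdgeLt x y u v → EdgeLt x y v u
      <E-irr   : ∀ {x y u v} → Adj x y → SameEdge x y u v → ¬ EdgeLt x y u v
      <E-trans : ∀ {x y u v s t} → Adj x y → Adj u v → Adj s t →
                 EdgeLt x y u v → EdgeLt u v s t → EdgeLt x y s t
      <E-total : ∀ {x y u v} → Adj x y → Adj u v →
                 SameEdge x y u v ⊎ EdgeLt x y u v ⊎ EdgeLt u v x y

  -- Walks, built by appending edges at the end (paths are compared from the end).
  data Walk : V → V → Set where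
    nil  : ∀ x → Walk x x
    snoc : ∀ {x y z} → Walk x y → Adj y z → Walk x z

  len : ∀ {x y} → Walk x y → ℕ
  len (nil _)    = zero
  len (snoc p _) = suc (len p)

  verts : ∀ {x y} → Walk x y → List V
  verts (nil x)              = x ∷ []
  verts (snoc {z = z} p _)   = verts p ∷ʳ z

  -- vertex at position i (distance i from the start along the walk);
  -- defaults to the last vertex when i exceeds the length
  nthL : V → List V → ℕ → V
  nthL d []       _       = d
  nthL d (v ∷ vs) zero    = v
  nthL d (v ∷ vs) (suc i) = nthL d vs i

  nth : ∀ {x y} → Walk x y → ℕ → V
  nth {y = y} p i = nthL y (verts p) i

  -- shortest-path distance, unfolded: d(x,y) ≤ k and d(x,y) ≥ k
  DistLe : V → V → ℕ → Set
  DistLe x y k = Σ (Walk x y) λ w → len w ≤ k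

  DistGe : V → V → ℕ → Set
  DistGe x y k = ∀ (w : Walk x y) → k ≤ len w

  -- distance between vertex sets (min over pairs; ∞ if a set is empty) is ≥ k
  SetDistGe : (V → Set) → (V → Set) → ℕ → Set
  SetDistGe S T k = ∀ x y → S x → T y → DistGe x y k

  module _ (O : EdgeOrder) where
    open EdgeOrder O

    data _⊏_ : ∀ {x y x' y'} → Walk x y → Walk x' y' → Set where
      nil⊏  : ∀ {x x' w z} {q : Walk x' w} {e : Adj w z} →
              nil x ⊏ snoc q e
      same⊏ : ∀ {x y z x' y' z'} {p : Walk x y} {e : Adj y z}
                {q : Walk x' y'} {e' : Adj y' z'} →
              SameEdge y z y' z' → p ⊏ q → snoc p e ⊏ snoc q e'
      diff⊏ : ∀ {x y z x' y' z'} {p : Walk x y} {e : Adj y z}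
                {q : Walk x' y'} {e' : Adj y' z'} →
              ¬ SameEdge y z y' z' → EdgeLt y z y' z' → snoc p e ⊏ snoc q e'

    IsP : ∀ {a b} → Walk a b → Set
    IsP {a} {b} p =
      (∀ (q : Walk a b) → len p ≤ len q) ×
      (∀ (q : Walk a b) → len q ≡ len p → verts p ≡ verts q ⊎ p ⊏ q)

    module _ (d ℓ : ℕ) (A B : V → Set) (P : ∀ a b → Walk a b) where

      InAB : V → Set
      InAB v = A v ⊎ B v

      Localized : Set
      Localized =
        (∀ v → A v → B v → ⊥) ×
        (∀ u v → InAB u → InAB v → u ≢ v → DistGe u v (suc ℓ)) ×
        (∀ a b → A a → B b →
           Σ (Walk a b) λ w → len w + 2 ^ (d + 2) + 3 ≤ 2 * ℓ)

      c⁺ : V → V → V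
      c⁺ a b = nth (P a b) (ℓ ∸ 3)

      c⁻ : V → V → V
      c⁻ a b = nth (P a b) (len (P a b) ∸ (ℓ ∸ 3))

      BallMeet : V → V → V → Set
      BallMeet c a b =
        DistLe c a ℓ × DistLe c b ℓ ×
        (∀ v → InAB v → DistLe c v ℓ → v ≡ a ⊎ v ≡ b)

      Independent : Set
      Independent =
        Localized ×
        (∀ a b → A a → B b → BallMeet (c⁺ a b) a b × BallMeet (c⁻ a b) a b)

      RSA : V → V → Set
      RSA a v = Σ V λ b → B b × Σ ℕ λ i → i ≤ ℓ ∸ 3 × v ≡ nth (P a b) i

      RSB : V → V → Set
      RSB b v = Σ V λ a → A a × Σ ℕ λ i →
        len (P a b) ∸ (ℓ ∸ 3) ≤ i × i ≤ len (P a b) × v ≡ nth (P a b) i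

{-# OPTIONS --safe #-}
-- Put r = ℓ - 3, so c_ab is the vertex of P_ab at position r and c_ba the one at |P_ab| - r.
-- Localization gives |P_ab| + 6 ≤ 2ℓ, i.e. |P_ab| ≤ 2r, so every vertex u of P_ab satisfies
-- d(c, u) + d(u, x) ≤ r for (c, x) = (c_ab, a) or (c_ba, b); root sections consist of such
-- vertices. Take u for (c, x) and v for (c', x') coming from two pairs as in (a) or (b), so
-- that neither anchor is an endpoint of the other pair. If d(u, v) ≤ 3, the walks
-- c → u → v → x' and c' → v → u → x have total length ≤ 2r + 6 = 2ℓ, so one of the balls
-- B(c, ℓ), B(c', ℓ) meets A ∪ B outside its own pair, against independence.
module Submission where

open import Defs
open import Data.Nat using (ℕ; zero; suc; _+_; _*_; _∸_; _^_; _≤_; _<_; z≤n; s≤s; _≤?_)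
open import Data.Nat.Properties
open import Data.Nat.Tactic.RingSolver using (solve-∀)
open import Data.List using (List; []; _∷_; _∷ʳ_; length)
open import Data.List.Properties using (length-++)
open import Data.List.Membership.Propositional using (_∈_)
open import Data.List.Relation.Unary.Any using (here; there)
open import Data.Product using (_×_; ∃; _,_; proj₁; proj₂)
open import Data.Sum using (_⊎_; inj₁; inj₂; [_,_]′)
open import Function using (_∘_)
open import Data.Empty using (⊥-elim)
open import Relation.Nullary using (¬_; yes; no; contradiction)
open import Relation.Binary.PropositionalEquality
  using (_≡_; _≢_; refl; sym; trans; cong; subst; subst₂; ≢-sym; module ≡-Reasoning)

+≤+⇒≤⊎≤ : ∀ {x y n} → x + y ≤ n + n → x ≤ n ⊎ y ≤ n
+≤+⇒≤⊎≤ {x} {y} {n} x+y≤n+n with x ≤? n | y ≤? n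
... | yes x≤n | _       = inj₁ x≤n
... | no _    | yes y≤n = inj₂ y≤n
... | no x≰n  | no y≰n  = ⊥-elim (≤⇒≯ x+y≤n+n (+-mono-< (≰⇒> x≰n) (≰⇒> y≰n)))

4≤2^[d+2] : ∀ d → 4 ≤ 2 ^ (d + 2)
4≤2^[d+2] d = subst (4 ≤_) (sym (^-distribˡ-+-* 2 d 2)) (*-monoˡ-≤ 4 (m^n>0 2 d))

[i∸k]+[n∸i]≡n∸k : ∀ {k i n} → k ≤ i → i ≤ n → (i ∸ k) + (n ∸ i) ≡ n ∸ k
[i∸k]+[n∸i]≡n∸k {k} {i} {n} k≤i i≤n = begin
  (i ∸ k) + (n ∸ i)  ≡⟨ sym (+-∸-comm (n ∸ i) k≤i) ⟩
  i + (n ∸ i) ∸ k    ≡⟨ cong (_∸ k) (m+[n∸m]≡n i≤n) ⟩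
  n ∸ k              ∎
  where open ≡-Reasoning

module _ (G : Graph) where
  open Graph G

  infixr 5 _++ʷ_
  _++ʷ_ : ∀ {x y z} → Walk G x y → Walk G y z → Walk G x z
  p ++ʷ nil _    = p
  p ++ʷ snoc q e = snoc (p ++ʷ q) e

  len-++ʷ : ∀ {x y z} (p : Walk G x y) (q : Walk G y z) → len G (p ++ʷ q) ≡ len G p + len G q
  len-++ʷ p (nil _)    = sym (+-identityʳ _)
  len-++ʷ p (snoc q e) = trans (cong suc (len-++ʷ p q)) (sym (+-suc _ _))

  reverseʷ : ∀ {x y} → Walk G x y → Walk G y x
  reverseʷ (nil x)            = nil x
  reverseʷ (snoc {z = z} p e) = snoc (nil z) (Adj-sym e) ++ʷ reverseʷ p

  len-reverseʷ : ∀ {x y} (p : Walk G x y) → len G (reverseʷ p) ≡ len G p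
  len-reverseʷ (nil x)            = refl
  len-reverseʷ (snoc {z = z} p e) =
    trans (len-++ʷ (snoc (nil z) (Adj-sym e)) (reverseʷ p)) (cong suc (len-reverseʷ p))

  DistLe-refl : ∀ x → DistLe G x x 0
  DistLe-refl x = nil x , z≤n

  DistLe-snoc : ∀ {x y z n} → DistLe G x y n → Adj y z → DistLe G x z (suc n)
  DistLe-snoc (w , w≤n) e = snoc w e , s≤s w≤n

  DistLe-mono : ∀ {x y m n} → m ≤ n → DistLe G x y m → DistLe G x y n
  DistLe-mono m≤n (w , w≤m) = w , ≤-trans w≤m m≤n

  DistLe-sym : ∀ {x y n} → DistLe G x y n → DistLe G y x n
  DistLe-sym (w , w≤n) = reverseʷ w , subst (_≤ _) (sym (len-reverseʷ w)) w≤n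

  DistLe-trans : ∀ {x y z m n} → DistLe G x y m → DistLe G y z n → DistLe G x z (m + n)
  DistLe-trans (w , w≤m) (w' , w'≤n) =
    w ++ʷ w' , subst (_≤ _) (sym (len-++ʷ w w')) (+-mono-≤ w≤m w'≤n)

  ¬DistLe⇒DistGe : ∀ {x y n} → ¬ DistLe G x y n → DistGe G x y (suc n)
  ¬DistLe⇒DistGe {n = n} x≁y w with suc n ≤? len G w
  ... | yes n<w = n<w
  ... | no n≮w  = contradiction (w , ≤-pred (≰⇒> n≮w)) x≁y

  DistGe-sym : ∀ {x y n} → DistGe G x y n → DistGe G y x n
  DistGe-sym x≥y w = subst (_ ≤_) (len-reverseʷ w) (x≥y (reverseʷ w))

  nthL-∷ʳ-< : ∀ d d' (xs : List V) z {i} → i < length xs → nthL G d (xs ∷ʳ z) i ≡ nthL G d' xs i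
  nthL-∷ʳ-< d d' (x ∷ xs) z {zero}  _         = refl
  nthL-∷ʳ-< d d' (x ∷ xs) z {suc i} (s≤s i<n) = nthL-∷ʳ-< d d' xs z i<n

  nthL-∷ʳ-length : ∀ d (xs : List V) z → nthL G d (xs ∷ʳ z) (length xs) ≡ z
  nthL-∷ʳ-length d []       z = refl
  nthL-∷ʳ-length d (x ∷ xs) z = nthL-∷ʳ-length d xs z

  ∈⇒nthL : ∀ d {u} (xs : List V) → u ∈ xs → ∃ λ i → i < length xs × u ≡ nthL G d xs i
  ∈⇒nthL d (x ∷ xs) (here u≡x) = zero , s≤s z≤n , u≡x
  ∈⇒nthL d (x ∷ xs) (there u∈xs) with ∈⇒nthL d xs u∈xs
  ... | i , i<n , u≡xsᵢ = suc i , s≤s i<n , u≡xsᵢ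

  length-verts : ∀ {x y} (p : Walk G x y) → length (verts G p) ≡ suc (len G p)
  length-verts (nil x)            = refl
  length-verts (snoc {z = z} p e) =
    trans (length-++ (verts G p)) (trans (+-comm _ 1) (cong suc (length-verts p)))

  nth-snoc : ∀ {x y z} (p : Walk G x y) (e : Adj y z) {i} → i ≤ len G p →
             nth G (snoc p e) i ≡ nth G p i
  nth-snoc {y = y} {z} p e i≤p =
    nthL-∷ʳ-< z y (verts G p) z (subst (_ <_) (sym (length-verts p)) (s≤s i≤p))

  nth-len : ∀ {x y} (p : Walk G x y) → nth G p (len G p) ≡ y
  nth-len (nil x)            = refl
  nth-len (snoc {z = z} p e) =
    subst (λ k → nthL G z (verts G p ∷ʳ z) k ≡ z) (length-verts p)
      (nthL-∷ʳ-length z (verts G p) z)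

  nth-0 : ∀ {x y} (p : Walk G x y) → nth G p 0 ≡ x
  nth-0 (nil x)    = refl
  nth-0 (snoc p e) = trans (nth-snoc p e z≤n) (nth-0 p)

  ∈-verts⇒nth : ∀ {x y u} (p : Walk G x y) → u ∈ verts G p →
                ∃ λ i → i ≤ len G p × u ≡ nth G p i
  ∈-verts⇒nth {y = y} p u∈p with ∈⇒nthL y (verts G p) u∈p
  ... | i , i<n , u≡pᵢ = i , ≤-pred (subst (i <_) (length-verts p) i<n) , u≡pᵢ

  nth-Adj : ∀ {x y} (p : Walk G x y) {i} → suc i ≤ len G p → Adj (nth G p i) (nth G p (suc i))
  nth-Adj (snoc q e) {i} (s≤s i≤q) with m≤n⇒m<n∨m≡n i≤q
  ... | inj₁ i<q =
    subst₂ Adj (sym (nth-snoc q e (<⇒≤ i<q))) (sym (nth-snoc q e i<q)) (nth-Adj q i<q)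
  ... | inj₂ refl =
    subst₂ Adj (sym (trans (nth-snoc q e ≤-refl) (nth-len q))) (sym (nth-len (snoc q e))) e

  nth-DistLe-+ : ∀ {x y} (p : Walk G x y) i n → i + n ≤ len G p →
                 DistLe G (nth G p i) (nth G p (i + n)) n
  nth-DistLe-+ p i zero _ =
    subst (λ k → DistLe G (nth G p i) (nth G p k) 0) (sym (+-identityʳ i)) (DistLe-refl _)
  nth-DistLe-+ p i (suc n) i+1+n≤p =
    subst (λ k → DistLe G (nth G p i) (nth G p k) (suc n)) (sym (+-suc i n))
      (DistLe-snoc (nth-DistLe-+ p i n (≤-trans (+-monoʳ-≤ i (n≤1+n n)) i+1+n≤p))
                   (nth-Adj p (subst (_≤ len G p) (+-suc i n) i+1+n≤p)))

  nth-DistLe : ∀ {x y} (p : Walk G x y) {i k} → i ≤ k → k ≤ len G p →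
               DistLe G (nth G p i) (nth G p k) (k ∸ i)
  nth-DistLe p {i} {k} i≤k k≤p =
    subst (λ j → DistLe G (nth G p i) (nth G p j) (k ∸ i)) (m+[n∸m]≡n i≤k)
      (nth-DistLe-+ p i (k ∸ i) (subst (_≤ len G p) (sym (m+[n∸m]≡n i≤k)) k≤p))

  record Between (c u x : V) (m : ℕ) : Set where
    constructor between
    field
      s t    : ℕ
      c~u    : DistLe G c u s
      u~x    : DistLe G u x t
      budget : s + t ≤ m

  nth-Between-start : ∀ {x y} (p : Walk G x y) {i k} → i ≤ k → k ≤ len G p →
                      Between (nth G p k) (nth G p i) x k
  nth-Between-start p {i} {k} i≤k k≤p = between (k ∸ i) i
    (DistLe-sym (nth-DistLe p i≤k k≤p))
    (subst (λ v → DistLe G (nth G p i) v i) (nth-0 p)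
      (DistLe-sym (nth-DistLe p z≤n (≤-trans i≤k k≤p))))
    (≤-reflexive (m∸n+n≡m i≤k))

  nth-Between-end : ∀ {x y} (p : Walk G x y) {i k} → k ≤ i → i ≤ len G p →
                    Between (nth G p k) (nth G p i) y (len G p ∸ k)
  nth-Between-end p {i} {k} k≤i i≤p = between (i ∸ k) (len G p ∸ i)
    (nth-DistLe p k≤i i≤p)
    (subst (λ v → DistLe G (nth G p i) v (len G p ∸ i)) (nth-len p) (nth-DistLe p i≤p ≤-refl))
    (≤-reflexive ([i∸k]+[n∸i]≡n∸k k≤i i≤p))

  Between-apart : ∀ {c c' u v x x' m k ℓ} → m + k ≤ ℓ →
                  Between c u x m → Between c' v x' m →
                  ¬ DistLe G c x' ℓ → ¬ DistLe G c' x ℓ → DistGe G u v (suc k)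
  Between-apart {k = k} {ℓ} m+k≤ℓ
    (between s t c~u u~x s+t≤m) (between s' t' c'~v v~x' s'+t'≤m) c≁x' c'≁x =
    ¬DistLe⇒DistGe λ u~v →
    [ c≁x'  ∘ (λ h → DistLe-mono h (DistLe-trans (DistLe-trans c~u u~v) v~x'))
    , c'≁x ∘ (λ h → DistLe-mono h (DistLe-trans (DistLe-trans c'~v (DistLe-sym u~v)) u~x))
    ]′ (+≤+⇒≤⊎≤ routes≤2ℓ)
    where
    regroup : ∀ s t s' t' k → s + k + t' + (s' + k + t) ≡ (s + t + k) + (s' + t' + k)
    regroup = solve-∀

    routes≤2ℓ : s + k + t' + (s' + k + t) ≤ ℓ + ℓ
    routes≤2ℓ = subst (_≤ ℓ + ℓ) (sym (regroup s t s' t' k))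
      (+-mono-≤ (≤-trans (+-monoˡ-≤ k s+t≤m) m+k≤ℓ) (≤-trans (+-monoˡ-≤ k s'+t'≤m) m+k≤ℓ))

module Independence (G : Graph) (O : EdgeOrder G) (d ℓ : ℕ) (A B : Graph.V G → Set)
  (P : ∀ a b → Walk G a b) (P-isP : ∀ a b → A a → B b → IsP G O (P a b))
  (indep : Independent G O d ℓ A B P) where
  open Graph G

  r : ℕ
  r = ℓ ∸ 3

  L : V → V → ℕ
  L a b = len G (P a b)

  cab cba : V → V → V
  cab = c⁺ G O d ℓ A B P
  cba = c⁻ G O d ℓ A B P

  A≢B : ∀ {a b} → A a → B b → a ≢ b
  A≢B a∈A b∈B refl = proj₁ (proj₁ indep) _ a∈A b∈B

  P-long : ∀ {a b} → A a → B b → suc ℓ ≤ L a b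
  P-long {a} {b} a∈A b∈B =
    proj₁ (proj₂ (proj₁ indep)) a b (inj₁ a∈A) (inj₂ b∈B) (A≢B a∈A b∈B) (P a b)

  P-short : ∀ {a b} → A a → B b → L a b + 6 ≤ 2 * ℓ
  P-short {a} {b} a∈A b∈B with proj₂ (proj₂ (proj₁ indep)) a b a∈A b∈B
  ... | w , w-short = begin
    L a b + 6                  ≤⟨ +-monoʳ-≤ (L a b) (n≤1+n 6) ⟩
    L a b + (4 + 3)            ≡⟨ sym (+-assoc (L a b) 4 3) ⟩
    L a b + 4 + 3              ≤⟨ +-monoˡ-≤ 3 (+-mono-≤ P≤w (4≤2^[d+2] d)) ⟩
    len G w + 2 ^ (d + 2) + 3  ≤⟨ w-short ⟩
    2 * ℓ                      ∎
    where
    open ≤-Reasoning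
    P≤w : L a b ≤ len G w
    P≤w = proj₁ (P-isP a b a∈A b∈B) w

  r+3≤ℓ : ∀ {a b} → A a → B b → r + 3 ≤ ℓ
  r+3≤ℓ {a} {b} a∈A b∈B =
    ≤-reflexive (m∸n+n≡m {ℓ} {3} (*-cancelˡ-≤ 2 (≤-trans (m≤n+m 6 (L a b)) (P-short a∈A b∈B))))

  r≤L : ∀ {a b} → A a → B b → r ≤ L a b
  r≤L a∈A b∈B = ≤-trans (m∸n≤m ℓ 3) (≤-trans (n≤1+n ℓ) (P-long a∈A b∈B))

  L∸r≤r : ∀ {a b} → A a → B b → L a b ∸ r ≤ r
  L∸r≤r {a} {b} a∈A b∈B = m≤n+o⇒m∸n≤o (L a b) r
    (subst (L a b ≤_) (trans (sym (*-distribˡ-∸ 2 ℓ 3)) (cong (r +_) (+-identityʳ r)))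
      (m+n≤o⇒m≤o∸n (L a b) (P-short a∈A b∈B)))

  root-a : ∀ {a b i} → A a → B b → i ≤ r → Between G (cab a b) (nth G (P a b) i) a r
  root-a {a} {b} a∈A b∈B i≤r = nth-Between-start G (P a b) i≤r (r≤L a∈A b∈B)

  root-b : ∀ {a b i} → A a → B b → L a b ∸ r ≤ i → i ≤ L a b →
           Between G (cba a b) (nth G (P a b) i) b r
  root-b {a} {b} a∈A b∈B L∸r≤i i≤L =
    subst (Between G _ _ b) (m∸[m∸n]≡n (r≤L a∈A b∈B)) (nth-Between-end G (P a b) L∸r≤i i≤L)

  near-an-end : ∀ {a b u} → A a → B b → u ∈ verts G (P a b) →
                Between G (cab a b) u a r ⊎ Between G (cba a b) u b r
  near-an-end {a} {b} a∈A b∈B u∈P with ∈-verts⇒nth G (P a b) u∈P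
  ... | i , i≤L , refl with i ≤? r
  ...   | yes i≤r = inj₁ (root-a a∈A b∈B i≤r)
  ...   | no i≰r  = inj₂ (root-b a∈A b∈B (≤-trans (L∸r≤r a∈A b∈B) (<⇒≤ (≰⇒> i≰r))) i≤L)

  ball-ab : ∀ {a b} → A a → B b → BallMeet G O d ℓ A B P (cab a b) a b
  ball-ab {a} {b} a∈A b∈B = proj₁ (proj₂ indep a b a∈A b∈B)

  ball-ba : ∀ {a b} → A a → B b → BallMeet G O d ℓ A B P (cba a b) a b
  ball-ba {a} {b} a∈A b∈B = proj₂ (proj₂ indep a b a∈A b∈B)

  ball-misses-A : ∀ {c a b z} → BallMeet G O d ℓ A B P c a b → B b → A z → z ≢ a →
                  ¬ DistLe G c z ℓ
  ball-misses-A (_ , _ , meet) b∈B z∈A z≢a c~z =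
    [ z≢a , A≢B z∈A b∈B ]′ (meet _ (inj₁ z∈A) c~z)

  ball-misses-B : ∀ {c a b z} → BallMeet G O d ℓ A B P c a b → A a → B z → z ≢ b →
                  ¬ DistLe G c z ℓ
  ball-misses-B (_ , _ , meet) a∈A z∈B z≢b c~z =
    [ (λ z≡a → A≢B a∈A z∈B (sym z≡a)) , z≢b ]′ (meet _ (inj₂ z∈B) c~z)

  a-ends-apart : ∀ {a a' b b' u v} → A a → A a' → B b → B b' → a ≢ a' →
                 Between G (cab a b) u a r → Between G (cab a' b') v a' r → DistGe G u v 4
  a-ends-apart a∈A a'∈A b∈B b'∈B a≢a' u~a v~a' = Between-apart G (r+3≤ℓ a∈A b∈B) u~a v~a'
    (ball-misses-A (ball-ab a∈A b∈B) b∈B a'∈A (≢-sym a≢a'))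
    (ball-misses-A (ball-ab a'∈A b'∈B) b'∈B a∈A a≢a')

  b-ends-apart : ∀ {a a' b b' u v} → A a → A a' → B b → B b' → b ≢ b' →
                 Between G (cba a b) u b r → Between G (cba a' b') v b' r → DistGe G u v 4
  b-ends-apart a∈A a'∈A b∈B b'∈B b≢b' u~b v~b' = Between-apart G (r+3≤ℓ a∈A b∈B) u~b v~b'
    (ball-misses-B (ball-ba a∈A b∈B) a∈A b'∈B (≢-sym b≢b'))
    (ball-misses-B (ball-ba a'∈A b'∈B) a'∈A b∈B b≢b')

  ab-ends-apart : ∀ {a a' b b' u v} → A a → A a' → B b → B b' → a ≢ a' → b ≢ b' →
                  Between G (cab a b) u a r → Between G (cba a' b') v b' r → DistGe G u v 4
  ab-ends-apart a∈A a'∈A b∈B b'∈B a≢a' b≢b' u~a v~b' = Between-apart G (r+3≤ℓ a∈A b∈B) u~a v~b'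
    (ball-misses-B (ball-ab a∈A b∈B) a∈A b'∈B (≢-sym b≢b'))
    (ball-misses-A (ball-ba a'∈A b'∈B) b'∈B a∈A a≢a')

  paths-apart : ∀ a a' b b' → A a → A a' → B b → B b' → a ≢ a' → b ≢ b' →
                ∀ u v → u ∈ verts G (P a b) → v ∈ verts G (P a' b') → DistGe G u v 4
  paths-apart a a' b b' a∈A a'∈A b∈B b'∈B a≢a' b≢b' u v u∈P v∈P'
    with near-an-end a∈A b∈B u∈P | near-an-end a'∈A b'∈B v∈P'
  ... | inj₁ u~a | inj₁ v~a' = a-ends-apart a∈A a'∈A b∈B b'∈B a≢a' u~a v~a'
  ... | inj₁ u~a | inj₂ v~b' = ab-ends-apart a∈A a'∈A b∈B b'∈B a≢a' b≢b' u~a v~b'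
  ... | inj₂ u~b | inj₁ v~a' =
    DistGe-sym G (ab-ends-apart a'∈A a∈A b'∈B b∈B (≢-sym a≢a') (≢-sym b≢b') v~a' u~b)
  ... | inj₂ u~b | inj₂ v~b' = b-ends-apart a∈A a'∈A b∈B b'∈B b≢b' u~b v~b'

  root-sections-A-apart : ∀ a a' → A a → A a' → a ≢ a' →
                          SetDistGe G (RSA G O d ℓ A B P a) (RSA G O d ℓ A B P a') 4
  root-sections-A-apart a a' a∈A a'∈A a≢a' _ _
                        (b , b∈B , i , i≤r , refl) (b' , b'∈B , j , j≤r , refl) =
    a-ends-apart a∈A a'∈A b∈B b'∈B a≢a' (root-a a∈A b∈B i≤r) (root-a a'∈A b'∈B j≤r)

  root-sections-B-apart : ∀ b b' → B b → B b' → b ≢ b' →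
                          SetDistGe G (RSB G O d ℓ A B P b) (RSB G O d ℓ A B P b') 4
  root-sections-B-apart b b' b∈B b'∈B b≢b' _ _
                        (a , a∈A , i , L∸r≤i , i≤L , refl) (a' , a'∈A , j , L∸r≤j , j≤L , refl) =
    b-ends-apart a∈A a'∈A b∈B b'∈B b≢b'
      (root-b a∈A b∈B L∸r≤i i≤L) (root-b a'∈A b'∈B L∸r≤j j≤L)

lemma21 : (G : Graph) (O : EdgeOrder G) (d ℓ : ℕ) (A B : Graph.V G → Set)
          (P : ∀ a b → Walk G a b) →
          (∀ a b → A a → B b → IsP G O (P a b)) →
          Independent G O d ℓ A B P →
          (∀ a a' b b' → A a → A a' → B b → B b' → a ≢ a' → b ≢ b' →
             ∀ u v → u ∈ verts G (P a b) → v ∈ verts G (P a' b') →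
             DistGe G u v 4)
          ×
          ((∀ a a' → A a → A a' → a ≢ a' →
              SetDistGe G (RSA G O d ℓ A B P a) (RSA G O d ℓ A B P a') 4)
           ×
           (∀ b b' → B b → B b' → b ≢ b' →
              SetDistGe G (RSB G O d ℓ A B P b) (RSB G O d ℓ A B P b') 4))
lemma21 G O d ℓ A B P P-isP indep = paths-apart , root-sections-A-apart , root-sections-B-apart
  where open Independence G O d ℓ A B P P-isP indep
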